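{- Let $R=(Z,A(R))$ be a finite digraph, $X,M\subseteq Z$ disjoint, $Y\subseteq Z$ with $M\cap Y=\emptyset$ and $M\cap N_R(y)=\emptyset$ for all $y\in Y$, and $\beta:X\to Y$ a map. Assume $X$ is convex in $R$ and there is no walk in $R$ starting in $M$ and ending in $Y$, and no walk starting in $Y$ and ending in $M$. Let $S$ be the digraph with $V(S)=Z$ and $A(S)=A_r\cup A_d\cup A_u$, where $A_r=A(R)\setminus((M\times X)\cup(X\times M))$, $A_d=\{m\beta(x): mx\in A(R)\cap(M\times X)\}$, $A_u=\{\beta(x)m: xm\in A(R)\cap(X\times M)\}$. If $R\in\mathfrak{T}_a$, then $S\in\mathfrak{T}_a$.
   Context: Digraphs have finite non-empty vertex set and arc set $A\subseteq V\times V$; $G^*$ is $G$ with loops $vv$ removed. $v,w$ adjacent if $vw$ or $wv$ is an arc; $N_R(v)$ = vertices $w\ne v$ adjacent to $v$. A walk is a sequence $v_0,\dots,v_I$ ($I\ge1$) with $v_{i-1}v_i$ arcs; closed if $v_0=v_I$; acyclic = no closed walk. $\mathfrak{T}_a$ = finite digraphs $G$ with $G^*$ acyclic (equivalently, every closed walk in $G$ is trivial, i.e. constant). A vertex set $X$ is convex iff every walk starting and ending in $X$ lies entirely in $X$. -}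

module Defs where

open import Data.Nat using (ℕ; NonZero)
open import Data.Fin using (Fin)
open import Data.Fin.Subset using (Subset; _∈_; _∉_)
open import Data.List using (List; []; _∷_)
open import Data.List.Relation.Unary.All using (All)
open import Data.Product using (Σ; ∃; _×_; _,_)
open import Data.Sum using (_⊎_)
open import Data.Empty using (⊥)
open import Relation.Nullary using (¬_; Dec)
open import Relation.Nullary.Decidable using (_×-dec_; _⊎-dec_; ¬?)
open import Data.Fin.Properties using (any?) renaming (_≟_ to _≟ᶠ_)
open import Data.Fin.Subset.Properties using (_∈?_)
open import Relation.Binary using (Decidable)
open import Relation.Binary.PropositionalEquality using (_≡_; _≢_)

record Digraph : Set₁ where
  field
    n       : ℕ
    {{nonEmpty}} : NonZero n
    Arc     : Fin n → Fin n → Set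
    arc?    : Decidable Arc

open Digraph public

Star : {n : ℕ} → (Fin n → Fin n → Set) → Fin n → Fin n → Set
Star E u v = E u v × u ≢ v

data Walk {n : ℕ} (E : Fin n → Fin n → Set) : Fin n → Fin n → Set where
  step : ∀ {u v} → E u v → Walk E u v
  _∷ʷ_ : ∀ {u v w} → E u v → Walk E v w → Walk E u w

vertices : ∀ {n} {E : Fin n → Fin n → Set} {u v} → Walk E u v → List (Fin n)
vertices {u = u} {v} (step _) = u ∷ v ∷ []
vertices {u = u} (_ ∷ʷ w) = u ∷ vertices w

Acyclic : ∀ {n} → (Fin n → Fin n → Set) → Set
Acyclic E = ∀ u → ¬ Walk E u u

InTa : Digraph → Set
InTa G = Acyclic (Star (Arc G))

Convex : (G : Digraph) → Subset (n G) → Set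
Convex G X = ∀ {u v} → u ∈ X → v ∈ X → (w : Walk (Arc G) u v) →
             All (_∈ X) (vertices w)

Adjacent : (G : Digraph) → Fin (n G) → Fin (n G) → Set
Adjacent G v w = Arc G v w ⊎ Arc G w v

InN : (G : Digraph) → Fin (n G) → Fin (n G) → Set
InN G v w = w ≢ v × Adjacent G v w

module _ (R : Digraph) (X M : Subset (n R)) (β : Fin (n R) → Fin (n R)) where
  Ar : Fin (n R) → Fin (n R) → Set
  Ar u v = Arc R u v × ¬ (u ∈ M × v ∈ X) × ¬ (u ∈ X × v ∈ M)

  Ad : Fin (n R) → Fin (n R) → Set
  Ad u v = Σ (Fin (n R)) λ x → x ∈ X × u ∈ M × Arc R u x × v ≡ β x

  Au : Fin (n R) → Fin (n R) → Set
  Au u v = Σ (Fin (n R)) λ x → x ∈ X × v ∈ M × Arc R x v × u ≡ β x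

  SArc : Fin (n R) → Fin (n R) → Set
  SArc u v = Ar u v ⊎ Ad u v ⊎ Au u v

  SArc? : Decidable SArc
  SArc? u v = Ar? ⊎-dec (Ad? ⊎-dec Au?)
    where
    Ar? = arc? R u v ×-dec ¬? ((u ∈? M) ×-dec (v ∈? X)) ×-dec ¬? ((u ∈? X) ×-dec (v ∈? M))
    Ad? = any? λ x → (x ∈? X) ×-dec (u ∈? M) ×-dec arc? R u x ×-dec (v ≟ᶠ β x)
    Au? = any? λ x → (x ∈? X) ×-dec (v ∈? M) ×-dec arc? R x v ×-dec (u ≟ᶠ β x)

  S : Digraph
  S = record { n = n R ; Arc = SArc ; arc? = SArc? }

-- A closed walk of S* that used only arcs of A_r would be a closed walk of R*, so it
-- contains an arc of A_d ∪ A_u, and it returns from the head of that arc to its tail.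
-- Along the way back the current vertex satisfies one of two invariants, both kept by
-- arcs of R: after an A_d-arc m β(x) it is reachable in R from Y; after an A_u-arc
-- β(x) m it is reachable in R from some m ∈ M entered by an arc from X.  In the first
-- state no A_d-arc can be taken, since it leaves M and Y does not reach M.  In the
-- second state no arc of A_d ∪ A_u can be taken: an A_d-arc m' x' would put m on a
-- walk between vertices of X, contradicting convexity, and an A_u-arc leaves Y, which
-- M does not reach.  Hence the walk cannot close up.
module Submission where

open import Defs
open import Data.Nat using (ℕ)
open import Data.Fin using (Fin)
open import Data.Fin.Subset using (Subset; _∈_)
open import Data.Product using (_×_; ∃; ∃₂; _,_; proj₁)
open import Data.Sum using (_⊎_; inj₁; inj₂; [_,_]′; map₁)
open import Data.Empty using (⊥; ⊥-elim)
open import Data.List.Relation.Unary.All using (All; _∷_)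
open import Function using (_∘_)
open import Relation.Nullary using (¬_)
open import Relation.Binary.PropositionalEquality using (_≡_; refl)
open import Relation.Binary.Construct.Union using (_∪_)
import Relation.Binary.Construct.Closure.ReflexiveTransitive as RT
open RT using (ε; _◅_; _◅◅_)

private
  variable
    k : ℕ
    E F : Fin k → Fin k → Set
    u v w : Fin k

Walk-map : (∀ {u v} → E u v → F u v) → Walk E u v → Walk F u v
Walk-map f (step e) = step (f e)
Walk-map f (e ∷ʷ p) = f e ∷ʷ Walk-map f p

Walk⇒Star : Walk E u v → RT.Star E u v
Walk⇒Star (step e) = e ◅ ε
Walk⇒Star (e ∷ʷ p) = e ◅ Walk⇒Star p

◅-Walk : E u v → RT.Star E v w → Walk E u w
◅-Walk e ε = step e
◅-Walk e (f ◅ p) = e ∷ʷ ◅-Walk f p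

Star⇒≡⊎Walk : RT.Star E u v → u ≡ v ⊎ Walk E u v
Star⇒≡⊎Walk ε = inj₁ refl
Star⇒≡⊎Walk (e ◅ p) = inj₂ (◅-Walk e p)

All-vertices-head : {P : Fin k → Set} (p : Walk E u v) → All P (vertices p) → P u
All-vertices-head (step _) (pu ∷ _) = pu
All-vertices-head (_ ∷ʷ _) (pu ∷ _) = pu

convex-successor : (G : Digraph) {X : Subset (n G)} {u v w : Fin (n G)} →
                   Convex G X → u ∈ X → v ∈ X →
                   Arc G u w → RT.Star (Arc G) w v → w ∈ X
convex-successor G conv uX vX e ε = vX
convex-successor G conv uX vX e (f ◅ p) with conv uX vX (e ∷ʷ ◅-Walk f p)
... | _ ∷ rest = All-vertices-head (◅-Walk f p) rest

Walk-∪-split : Walk (E ∪ F) u v →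
               Walk E u v ⊎ ∃₂ λ a b → RT.Star (E ∪ F) u a × F a b × RT.Star (E ∪ F) b v
Walk-∪-split (step (inj₁ e)) = inj₁ (step e)
Walk-∪-split (step (inj₂ f)) = inj₂ (_ , _ , ε , f , ε)
Walk-∪-split (inj₂ f ∷ʷ p) = inj₂ (_ , _ , ε , f , Walk⇒Star p)
Walk-∪-split (inj₁ e ∷ʷ p) with Walk-∪-split p
... | inj₁ q = inj₁ (e ∷ʷ q)
... | inj₂ (a , b , pre , f , post) = inj₂ (a , b , inj₁ e ◅ pre , f , post)

closed-Walk-∪ : Walk (E ∪ F) u u → Walk E u u ⊎ ∃₂ λ a b → F a b × RT.Star (E ∪ F) b a
closed-Walk-∪ p with Walk-∪-split p
... | inj₁ q = inj₁ q
... | inj₂ (a , b , pre , f , post) = inj₂ (a , b , f , post ◅◅ pre)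

module Rerouting (R : Digraph) (X M Y : Subset (n R)) (β : Fin (n R) → Fin (n R))
    (X∩M=∅ : ∀ z → z ∈ X → z ∈ M → ⊥)
    (M∩Y=∅ : ∀ z → z ∈ M → z ∈ Y → ⊥)
    (β∈Y : ∀ x → x ∈ X → β x ∈ Y)
    (X-convex : Convex R X)
    (M↛Y : ∀ m y → m ∈ M → y ∈ Y → ¬ Walk (Arc R) m y)
    (Y↛M : ∀ y m → y ∈ Y → m ∈ M → ¬ Walk (Arc R) y m)
  where

  V : Set
  V = Fin (n R)

  Reach : V → V → Set
  Reach = RT.Star (Arc R)

  Rerouted : V → V → Set
  Rerouted = Ad R X M β ∪ Au R X M β

  M↛⋆Y : ∀ {m y} → m ∈ M → y ∈ Y → ¬ Reach m y
  M↛⋆Y mM yY p with Star⇒≡⊎Walk p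
  ... | inj₁ refl = M∩Y=∅ _ mM yY
  ... | inj₂ walk = M↛Y _ _ mM yY walk

  Y↛⋆M : ∀ {y m} → y ∈ Y → m ∈ M → ¬ Reach y m
  Y↛⋆M yY mM p with Star⇒≡⊎Walk p
  ... | inj₁ refl = M∩Y=∅ _ mM yY
  ... | inj₂ walk = Y↛M _ _ yY mM walk

  ReachedFromY : V → Set
  ReachedFromY u = ∃ λ y → y ∈ Y × Reach y u

  ReachedFromXM : V → Set
  ReachedFromXM u = ∃₂ λ x m → x ∈ X × m ∈ M × Arc R x m × Reach m u

  Ad⇒ReachedFromY : ∀ {a b} → Ad R X M β a b → ReachedFromY b
  Ad⇒ReachedFromY (x , xX , _ , _ , refl) = β x , β∈Y x xX , ε

  Au⇒ReachedFromXM : ∀ {a b} → Au R X M β a b → ReachedFromXM b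
  Au⇒ReachedFromXM (x , xX , bM , e , _) = x , _ , xX , bM , e , ε

  ReachedFromY⇒¬Ad : ∀ {a b} → ReachedFromY a → ¬ Ad R X M β a b
  ReachedFromY⇒¬Ad (y , yY , p) (_ , _ , aM , _ , _) = Y↛⋆M yY aM p

  ReachedFromXM⇒¬Rerouted : ∀ {a b} → ReachedFromXM a → ¬ Rerouted a b
  ReachedFromXM⇒¬Rerouted (x₀ , m , x₀X , mM , e₀ , p) (inj₁ (x , xX , _ , e , _)) =
    X∩M=∅ m (convex-successor R X-convex x₀X xX e₀ (p ◅◅ e ◅ ε)) mM
  ReachedFromXM⇒¬Rerouted (_ , _ , _ , mM , _ , p) (inj₂ (x , xX , _ , _ , refl)) =
    M↛⋆Y mM (β∈Y x xX) p

  ReachedFromXM-Star : ∀ {u v} → ReachedFromXM u → RT.Star (Arc R ∪ Rerouted) u v →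
                       ReachedFromXM v
  ReachedFromXM-Star s ε = s
  ReachedFromXM-Star (x , m , xX , mM , e₀ , p) (inj₁ e ◅ q) =
    ReachedFromXM-Star (x , m , xX , mM , e₀ , p ◅◅ e ◅ ε) q
  ReachedFromXM-Star s (inj₂ r ◅ _) = ⊥-elim (ReachedFromXM⇒¬Rerouted s r)

  ReachedFromY-Star : ∀ {u v} → ReachedFromY u → RT.Star (Arc R ∪ Rerouted) u v →
                      ReachedFromY v ⊎ ReachedFromXM v
  ReachedFromY-Star s ε = inj₁ s
  ReachedFromY-Star (y , yY , p) (inj₁ e ◅ q) = ReachedFromY-Star (y , yY , p ◅◅ e ◅ ε) q
  ReachedFromY-Star s (inj₂ (inj₁ d) ◅ _) = ⊥-elim (ReachedFromY⇒¬Ad s d)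
  ReachedFromY-Star s (inj₂ (inj₂ up) ◅ q) = inj₂ (ReachedFromXM-Star (Au⇒ReachedFromXM up) q)

  Rerouted-not-on-cycle : ∀ {a b} → Rerouted a b → ¬ RT.Star (Arc R ∪ Rerouted) b a
  Rerouted-not-on-cycle (inj₁ d) back with ReachedFromY-Star (Ad⇒ReachedFromY d) back
  ... | inj₁ s = ReachedFromY⇒¬Ad s d
  ... | inj₂ s = ReachedFromXM⇒¬Rerouted s (inj₁ d)
  Rerouted-not-on-cycle (inj₂ up) back =
    ReachedFromXM⇒¬Rerouted (ReachedFromXM-Star (Au⇒ReachedFromXM up) back) (inj₂ up)

lemma7 : (R : Digraph) (X M Y : Subset (n R)) (β : Fin (n R) → Fin (n R))
    → (∀ z → z ∈ X → z ∈ M → ⊥)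
    → (∀ z → z ∈ M → z ∈ Y → ⊥)
    → (∀ y m → y ∈ Y → m ∈ M → ¬ InN R y m)
    → (∀ x → x ∈ X → β x ∈ Y)
    → Convex R X
    → (∀ m y → m ∈ M → y ∈ Y → ¬ Walk (Arc R) m y)
    → (∀ y m → y ∈ Y → m ∈ M → ¬ Walk (Arc R) y m)
    → InTa R
    → InTa (S R X M β)
lemma7 R X M Y β X∩M=∅ M∩Y=∅ _ β∈Y X-convex M↛Y Y↛M R-acyclic u cycle =
  [ (λ cycleInAr → R-acyclic u (Walk-map (λ ((e , _) , a≢b) → e , a≢b) cycleInAr))
  , (λ (_ , _ , r , back) → Rerouted-not-on-cycle r (RT.map (map₁ (proj₁ ∘ proj₁)) back))
  ]′ (closed-Walk-∪ (Walk-map separateRerouted cycle))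
  where
  open Rerouting R X M Y β X∩M=∅ M∩Y=∅ β∈Y X-convex M↛Y Y↛M
  separateRerouted : ∀ {a b} → Star (S R X M β .Arc) a b → (Star (Ar R X M β) ∪ Rerouted) a b
  separateRerouted (arc , a≢b) = [ (λ ar → inj₁ (ar , a≢b)) , inj₂ ]′ arc
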